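{- Let $m\ge 9$. Let $G_{12}$ be the voltage graph over $\mathbb{Z}_m$ built as follows. The tree part: a pinned vertex $x^{*}$ adjacent to $x$; vertices $x_b$ for the bit strings $b\in\{0,1,00,01,10,11,010,011,100,101,110,111\}$ and all bit strings of length $4$ beginning with $01$, $10$ or $11$, each $x_b$ joined to its parent ($x_0,x_1$ to $x$; $x_{b0},x_{b1}$ to $x_b$); a pinned vertex $y^{*}$ adjacent to $y$, and vertices $y_0,y_1,y_{01},y_{10},y_{11},y_{010},y_{011},y_{100},y_{101},y_{110},y_{111}$ each joined to its parent ($y_0,y_1$ to $y$, $y_{01}$ to $y_0$, $y_{10},y_{11}$ to $y_1$, $y_{b0},y_{b1}$ to $y_b$); an identical copy of this last tree with $y$ replaced by $z$ (pinned vertex $z^{*}$); and the edges $x_{00}y_0$ and $x_{00}z_0$. All these edges have voltage $0$. Then add the labelled arcs $x_{0100}\to y_{010}$ (1), $x_{0101}\to y_{011}$ (2), $x_{0110}\to y_{100}$ (1), $x_{0111}\to y_{101}$ (2), $x_{1000}\to y_{010}$ (2), $x_{1001}\to y_{011}$ (1), $x_{1010}\to y_{110}$ (1), $x_{1011}\to y_{111}$ (2), $x_{1100}\to y_{100}$ (2), $x_{1101}\to y_{101}$ (1), $x_{1110}\to y_{110}$ (3), $x_{1111}\to y_{111}$ ($-1$), $x_{0100}\to z_{110}$ (2), $x_{0101}\to z_{111}$ (1), $x_{0110}\to z_{100}$ ($-1$), $x_{0111}\to z_{101}$ (3), $x_{1000}\to z_{010}$ ($-1$), $x_{1001}\to z_{011}$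 (3), $x_{1010}\to z_{100}$ (1), $x_{1011}\to z_{101}$ ($-1$), $x_{1100}\to z_{010}$ ($-3$), $x_{1101}\to z_{011}$ ($-2$), $x_{1110}\to z_{110}$ ($-1$), $x_{1111}\to z_{111}$ (2). Then the derived graph $(G_{12};m)$ has girth $12$; it is a $(3,m;12)$-graph with three vertices of degree $m$ (namely $x^{*},y^{*},z^{*}$) and $49m$ vertices of degree $3$.
   Context: A voltage graph over $\mathbb{Z}_m$ is a finite directed multigraph with arc labels in $\mathbb{Z}_m$; some degree-$1$ vertices are pinned. Derived graph $(G,m)$: each non-pinned vertex $v$ gives $m$ vertices $v^0,\dots,v^{m-1}$; each pinned vertex $v^{*}$ gives a single vertex; an arc $v\to w$ labelled $a$ between non-pinned vertices gives edges $v^iw^{i+a}$ for all $i$ (indices mod $m$); an edge $v^{*}w$ with $v^{*}$ pinned gives edges $v^{*}w^i$ for all $i$. A $(3,m;g)$-graph is a graph of girth $g$ all of whose vertices have degree $3$ or $m$. -}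

module Defs where

open import Data.Nat using (ℕ; zero; suc; _+_; _*_; _≤_; NonZero)
open import Data.Nat.DivMod using (_mod_)
open import Data.Integer using (ℤ; +_; -_)
open import Data.Integer.DivMod using (_%ℕ_)
open import Data.Fin using (Fin; toℕ; #_)
open import Data.Fin.Properties using () renaming (_≟_ to _≟ᶠ_)
open import Data.Product using (Σ; _×_; _,_)
open import Data.Product.Properties using () renaming (≡-dec to ×-≡-dec)
open import Data.Sum using (_⊎_; inj₁; inj₂)
open import Data.Sum.Properties using () renaming (≡-dec to ⊎-≡-dec)
open import Data.List using (List; []; _∷_; _++_; map; concatMap; length; filter; allFin; lookup)
open import Data.Nat.ListAction using (sum)
open import Data.Empty using (⊥)
open import Function.Definitions using (Injective)
open import Relation.Binary.PropositionalEquality using (_≡_)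
open import Relation.Nullary using (Dec; yes; no)
open import Relation.Nullary.Decidable using (⌊_⌋)

-- Finite multigraphs: a vertex type with an explicit enumeration and
-- decidable equality, and a list of edges (each edge = ordered pair of
-- endpoints; edges are identified by their position in the list, so
-- parallel edges are allowed).

record MultiGraph : Set₁ where
  field
    Vtx    : Set
    _≟V_   : (u v : Vtx) → Dec (u ≡ v)
    vtxs   : List Vtx          -- enumeration of all vertices (each exactly once)
    edges  : List (Vtx × Vtx)

  Edge : Set
  Edge = Fin (length edges)

  ends : Edge → Vtx × Vtx
  ends e = lookup edges e

  [_≡?_] : Vtx → Vtx → ℕ
  [ u ≡? v ] with u ≟V v
  ... | yes _ = 1
  ... | no  _ = 0

  -- degree (a loop would count twice)
  deg : Vtx → ℕ
  deg v = sum (map (λ { (a , b) → [ a ≡? v ] + [ b ≡? v ] }) edges)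

  #deg : ℕ → ℕ
  #deg d = length (filter (λ v → Data.Nat._≟_ (deg v) d) vtxs)

  Joins : Edge → Vtx → Vtx → Set
  Joins e u v with ends e
  ... | (a , b) = ((a ≡ u) × (b ≡ v)) ⊎ ((a ≡ v) × (b ≡ u))

  next : {n : ℕ} → Fin (suc n) → Fin (suc n)
  next {n} j = (suc (toℕ j)) mod (suc n)

  HasCycle : ℕ → Set
  HasCycle zero    = ⊥
  HasCycle (suc n) =
    Σ (Fin (suc n) → Vtx) λ f → Σ (Fin (suc n) → Edge) λ g →
      Injective _≡_ _≡_ f × Injective _≡_ _≡_ g × (∀ j → Joins (g j) (f j) (f (next j)))

  HasGirth : ℕ → Set
  HasGirth g = HasCycle g × (∀ k → HasCycle k → g ≤ k)

record VoltageGraph : Set where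
  field
    nV    : ℕ
    nP    : ℕ
    arcs  : List (Fin nV × Fin nV × ℤ)   -- arc v → w with voltage a
    pins  : List (Fin nP × Fin nV)       -- edge v* w, v* pinned

shift : (m : ℕ) .{{_ : NonZero m}} → Fin m → ℤ → Fin m
shift m i a = (toℕ i + (a %ℕ m)) mod m

allPairs : (n m : ℕ) → List (Fin n × Fin m)
allPairs n m = concatMap (λ v → map (λ i → (v , i)) (allFin m)) (allFin n)

Derived : VoltageGraph → (m : ℕ) .{{_ : NonZero m}} → MultiGraph
Derived G m = record
  { Vtx   = (Fin nV × Fin m) ⊎ Fin nP
  ; _≟V_  = ⊎-≡-dec (×-≡-dec _≟ᶠ_ _≟ᶠ_) _≟ᶠ_
  ; vtxs  = map inj₁ (allPairs nV m) ++ map inj₂ (allFin nP)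
  ; edges = concatMap (λ { (v , w , a) → map (λ i → (inj₁ (v , i) , inj₁ (w , shift m i a))) (allFin m) }) arcs
         ++ concatMap (λ { (p , w) → map (λ i → (inj₂ p , inj₁ (w , i))) (allFin m) }) pins
  }
  where open VoltageGraph G

module G12-vertices where
  x x0 x1 x00 x01 x10 x11 x010 x011 x100 x101 x110 x111 : Fin 49
  x0100 x0101 x0110 x0111 x1000 x1001 x1010 x1011 x1100 x1101 x1110 x1111 : Fin 49
  y y0 y1 y01 y10 y11 y010 y011 y100 y101 y110 y111 : Fin 49
  z z0 z1 z01 z10 z11 z010 z011 z100 z101 z110 z111 : Fin 49
  x = # 0 ; x0 = # 1 ; x1 = # 2 ; x00 = # 3 ; x01 = # 4 ; x10 = # 5 ; x11 = # 6
  x010 = # 7 ; x011 = # 8 ; x100 = # 9 ; x101 = # 10 ; x110 = # 11 ; x111 = # 12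
  x0100 = # 13 ; x0101 = # 14 ; x0110 = # 15 ; x0111 = # 16
  x1000 = # 17 ; x1001 = # 18 ; x1010 = # 19 ; x1011 = # 20
  x1100 = # 21 ; x1101 = # 22 ; x1110 = # 23 ; x1111 = # 24
  y = # 25 ; y0 = # 26 ; y1 = # 27 ; y01 = # 28 ; y10 = # 29 ; y11 = # 30
  y010 = # 31 ; y011 = # 32 ; y100 = # 33 ; y101 = # 34 ; y110 = # 35 ; y111 = # 36
  z = # 37 ; z0 = # 38 ; z1 = # 39 ; z01 = # 40 ; z10 = # 41 ; z11 = # 42
  z010 = # 43 ; z011 = # 44 ; z100 = # 45 ; z101 = # 46 ; z110 = # 47 ; z111 = # 48
  x* y* z* : Fin 3
  x* = # 0 ; y* = # 1 ; z* = # 2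

open G12-vertices public

private
  e0 : Fin 49 → Fin 49 → Fin 49 × Fin 49 × ℤ
  e0 v w = (v , w , + 0)

G12 : VoltageGraph
G12 = record
  { nV   = 49
  ; nP   = 3
  ; arcs =
      e0 x x0 ∷ e0 x x1 ∷ e0 x0 x00 ∷ e0 x0 x01 ∷ e0 x1 x10 ∷ e0 x1 x11 ∷
      e0 x01 x010 ∷ e0 x01 x011 ∷ e0 x10 x100 ∷ e0 x10 x101 ∷ e0 x11 x110 ∷ e0 x11 x111 ∷
      e0 x010 x0100 ∷ e0 x010 x0101 ∷ e0 x011 x0110 ∷ e0 x011 x0111 ∷
      e0 x100 x1000 ∷ e0 x100 x1001 ∷ e0 x101 x1010 ∷ e0 x101 x1011 ∷
      e0 x110 x1100 ∷ e0 x110 x1101 ∷ e0 x111 x1110 ∷ e0 x111 x1111 ∷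
      e0 y y0 ∷ e0 y y1 ∷ e0 y0 y01 ∷ e0 y1 y10 ∷ e0 y1 y11 ∷
      e0 y01 y010 ∷ e0 y01 y011 ∷ e0 y10 y100 ∷ e0 y10 y101 ∷ e0 y11 y110 ∷ e0 y11 y111 ∷
      e0 z z0 ∷ e0 z z1 ∷ e0 z0 z01 ∷ e0 z1 z10 ∷ e0 z1 z11 ∷
      e0 z01 z010 ∷ e0 z01 z011 ∷ e0 z10 z100 ∷ e0 z10 z101 ∷ e0 z11 z110 ∷ e0 z11 z111 ∷
      e0 x00 y0 ∷ e0 x00 z0 ∷
      (x0100 , y010 , + 1) ∷ (x0101 , y011 , + 2) ∷ (x0110 , y100 , + 1) ∷ (x0111 , y101 , + 2) ∷
      (x1000 , y010 , + 2) ∷ (x1001 , y011 , + 1) ∷ (x1010 , y110 , + 1) ∷ (x1011 , y111 , + 2) ∷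
      (x1100 , y100 , + 2) ∷ (x1101 , y101 , + 1) ∷ (x1110 , y110 , + 3) ∷ (x1111 , y111 , - (+ 1)) ∷
      (x0100 , z110 , + 2) ∷ (x0101 , z111 , + 1) ∷ (x0110 , z100 , - (+ 1)) ∷ (x0111 , z101 , + 3) ∷
      (x1000 , z010 , - (+ 1)) ∷ (x1001 , z011 , + 3) ∷ (x1010 , z100 , + 1) ∷ (x1011 , z101 , - (+ 1)) ∷
      (x1100 , z010 , - (+ 3)) ∷ (x1101 , z011 , - (+ 2)) ∷ (x1110 , z110 , - (+ 1)) ∷ (x1111 , z111 , + 2) ∷
      []
  ; pins = (x* , x) ∷ (y* , y) ∷ (z* , z) ∷ []
  }

module Submission where

-- The derived graph (G₁₂, m) covers G₁₂: a vertex v^i lying over an unpinned vertex v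
-- has the degree of v in G₁₂ (here 3), and a pinned vertex has m times its degree
-- (here 1), which gives all degree statements.  The lifts at levels 0 and 1 of the
-- voltage-0 path x* x x₀ x₀₀ y₀ y y* together form a 12-cycle.  Conversely, a cycle of
-- length k ≤ 11 projects to a closed walk of length k in G₁₂ that never turns back at
-- an unpinned vertex (G₁₂ is simple, so turning back there would repeat a vertex of
-- the cycle).  An exhaustive search shows that every such walk avoids the pinned
-- vertices and has net voltage s with 0 < |s| < 9 ≤ m; but the lift of a closed walk
-- avoiding pinned vertices only closes up when m divides its net voltage.

open import Data.Bool using (Bool; true; T; not; _∧_; _∨_)
import Data.Bool.Properties as Bool
open import Data.Bool.ListAction using (all)
open import Data.Empty using (⊥; ⊥-elim)
open import Data.Fin as Fin using (Fin; toℕ)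
import Data.Fin.Properties as Finₚ
open import Data.Integer as ℤ using (ℤ; +_; -_; ∣_∣)
import Data.Integer.Properties as ℤ
open import Data.Integer.Divisibility.Signed using (_∣_; divides; ∣-refl; ∣⇒∣ᵤ; ∣m∣n⇒∣m+n; ∣m⇒∣-m)
open import Data.Integer.DivMod using (_%ℕ_; _/ℕ_; a≡a%ℕn+[a/ℕn]*n)
open import Data.List as List using (List; []; _∷_; _++_; map; concatMap; allFin; tabulate; length; filter; lookup; downFrom; drop; head)
import Data.List.Properties as List
open import Data.List.Membership.Propositional using (_∈_; _∉_; find)
open import Data.List.Membership.Propositional.Properties
  using (∈-map⁺; ∈-map⁻; ∈-concatMap⁺; ∈-concatMap⁻; ∈-allFin; ∈-lookup; ∈-downFrom⁺)
open import Data.List.Relation.Binary.Disjoint.Propositional using (Disjoint)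
open import Data.List.Relation.Unary.All as All using (All)
import Data.List.Relation.Unary.All.Properties as All
open import Data.List.Relation.Unary.AllPairs as AllPairs using (_∷_)
import Data.List.Relation.Unary.AllPairs.Properties as AllPairs
open import Data.List.Relation.Unary.Any as Any using (here; there)
open import Data.List.Relation.Unary.Any.Properties using (lookup-index)
open import Data.List.Relation.Unary.Unique.Propositional using (Unique)
import Data.List.Relation.Unary.Unique.Propositional.Properties as Unique
open import Data.Maybe using (fromMaybe)
open import Data.Nat as ℕ using (ℕ; zero; suc; NonZero; _*_; _≤_; _<_; s≤s; z≤n; _≤ᵇ_; _<ᵇ_; _≡ᵇ_)
import Data.Nat.Properties as ℕ
import Data.Nat.Divisibility as ℕᵈ
open import Data.Nat.DivMod using (_mod_; _%_; _/_; m≡m%n+[m/n]*n; m%n<n)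
open import Data.Nat.GeneralisedArithmetic using (fold)
open import Data.Nat.ListAction using (sum)
open import Data.Nat.ListAction.Properties using (sum-++)
import Data.Nat.Tactic.RingSolver as ℕ-Ring
import Data.Integer.Tactic.RingSolver as ℤ-Ring
open import Data.Product using (Σ-syntax; _×_; _,_; proj₁; proj₂; swap)
open import Data.Product.Properties using () renaming (≡-dec to ×-≡-dec)
open import Data.Sum using (_⊎_; inj₁; inj₂; reduce)
open import Data.Sum.Properties using () renaming (≡-dec to ⊎-≡-dec)
open import Data.Unit using (⊤; tt)
open import Data.Vec using ([]; _∷_) renaming (lookup to lookupᵥ)
open import Function using (_∘_)
open import Function.Bundles using (Equivalence)
open import Function.Definitions using (Injective)
open import Level using (0ℓ)
open import Relation.Binary.Bundles using (Setoid)
open import Relation.Binary.Definitions using (DecidableEquality)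
open import Relation.Binary.PropositionalEquality
import Relation.Binary.Reasoning.Setoid as SetoidReasoning
open import Relation.Nullary using (¬_; Dec; yes; no; contradiction)
open import Relation.Nullary.Decidable using (toWitness; ¬?; _×-dec_; _⊎-dec_; _→-dec_)
open import Defs

module _ {A B : Set} where

  unique-map⇒injective : ∀ {f : A → B} {xs x y} → Unique (map f xs) → x ∈ xs → y ∈ xs → f x ≡ f y → x ≡ y
  unique-map⇒injective {xs = _ ∷ _} _ (here refl) (here refl) _ = refl
  unique-map⇒injective {f = f} {_ ∷ _} (fx∉ ∷ _) (here refl) (there y∈) fx≡fy =
    contradiction fx≡fy (All.lookup fx∉ (∈-map⁺ f y∈))
  unique-map⇒injective {f = f} {_ ∷ _} (fy∉ ∷ _) (there x∈) (here refl) fx≡fy =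
    contradiction (sym fx≡fy) (All.lookup fy∉ (∈-map⁺ f x∈))
  unique-map⇒injective {xs = _ ∷ _} (_ ∷ u) (there x∈) (there y∈) fx≡fy = unique-map⇒injective u x∈ y∈ fx≡fy

  unique-concatMap : ∀ {C : Set} {f : A → List B} {κ : B → C} {h : A → C} →
                     (∀ {x y} → y ∈ f x → κ y ≡ h x) → (∀ x → Unique (f x)) →
                     ∀ {xs} → Unique (map h xs) → Unique (concatMap f xs)
  unique-concatMap {f = f} {κ} {h} κ≡h f-unique {xs} h-unique =
    Unique.concat⁺ (All.map⁺ (All.universal f-unique xs))
                   (AllPairs.map⁺ (AllPairs.map disjoint (AllPairs.map⁻ h-unique)))
    where
    disjoint : ∀ {x x′} → h x ≢ h x′ → Disjoint (f x) (f x′)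
    disjoint hx≢hx′ (y∈fx , y∈fx′) = hx≢hx′ (trans (sym (κ≡h y∈fx)) (κ≡h y∈fx′))

  length-concatMap : ∀ (f : A → List B) {c} → (∀ x → length (f x) ≡ c) → ∀ xs → length (concatMap f xs) ≡ length xs * c
  length-concatMap f f-length []       = refl
  length-concatMap f f-length (x ∷ xs) =
    trans (List.length-++ (f x)) (cong₂ ℕ._+_ (f-length x) (length-concatMap f f-length xs))

  sum-map-concatMap : ∀ (h : B → ℕ) (f : A → List B) xs →
                      sum (map h (concatMap f xs)) ≡ sum (map (λ x → sum (map h (f x))) xs)
  sum-map-concatMap h f []       = refl
  sum-map-concatMap h f (x ∷ xs) = begin
    sum (map h (f x ++ concatMap f xs))                  ≡⟨ cong sum (List.map-++ h (f x) _) ⟩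
    sum (map h (f x) ++ map h (concatMap f xs))          ≡⟨ sum-++ (map h (f x)) _ ⟩
    sum (map h (f x)) ℕ.+ sum (map h (concatMap f xs))   ≡⟨ cong (ℕ._+_ (sum (map h (f x)))) (sum-map-concatMap h f xs) ⟩
    sum (map h (f x)) ℕ.+ sum (map (λ x → sum (map h (f x))) xs) ∎
    where open ≡-Reasoning

module _ {A : Set} where
  open import Data.Nat using (_+_)

  sum-map-cong : ∀ {f g : A → ℕ} → (∀ x → f x ≡ g x) → ∀ xs → sum (map f xs) ≡ sum (map g xs)
  sum-map-cong f≗g xs = cong sum (List.map-cong f≗g xs)

  sum-map-+ : ∀ (f g : A → ℕ) xs → sum (map (λ x → f x + g x) xs) ≡ sum (map f xs) + sum (map g xs)
  sum-map-+ f g []       = refl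
  sum-map-+ f g (x ∷ xs) = trans (cong (_+_ (f x + g x)) (sum-map-+ f g xs)) (interchange (f x) (g x) _ _)
    where
    interchange : ∀ a b c d → a + b + (c + d) ≡ a + c + (b + d)
    interchange = ℕ-Ring.solve-∀

  sum-map-const : ∀ c (xs : List A) → sum (map (λ _ → c) xs) ≡ length xs * c
  sum-map-const c []       = refl
  sum-map-const c (x ∷ xs) = cong (_+_ c) (sum-map-const c xs)

  sum-map-zero : ∀ {f : A → ℕ} → (∀ x → f x ≡ 0) → ∀ xs → sum (map f xs) ≡ 0
  sum-map-zero f≗0 xs = trans (sum-map-cong f≗0 xs) (trans (sum-map-const 0 xs) (ℕ.*-zeroʳ (length xs)))

  sum-map-* : ∀ c (f : A → ℕ) xs → sum (map (λ x → c * f x) xs) ≡ c * sum (map f xs)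
  sum-map-* c f []       = sym (ℕ.*-zeroʳ c)
  sum-map-* c f (x ∷ xs) = trans (cong (_+_ (c * f x)) (sum-map-* c f xs)) (sym (ℕ.*-distribˡ-+ c (f x) _))

sum-tabulate-zero : ∀ {n} (P : Fin n → ℕ) → (∀ i → P i ≡ 0) → sum (tabulate P) ≡ 0
sum-tabulate-zero {zero}  P P≡0 = refl
sum-tabulate-zero {suc n} P P≡0 = cong₂ ℕ._+_ (P≡0 Fin.zero) (sum-tabulate-zero (P ∘ Fin.suc) (P≡0 ∘ Fin.suc))

sum-tabulate-one-hot : ∀ {n} (P : Fin n → ℕ) i₀ → P i₀ ≡ 1 → (∀ i → i ≢ i₀ → P i ≡ 0) → sum (tabulate P) ≡ 1
sum-tabulate-one-hot P Fin.zero     Pi₀≡1 P≡0 =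
  cong₂ ℕ._+_ Pi₀≡1 (sum-tabulate-zero (P ∘ Fin.suc) (λ i → P≡0 (Fin.suc i) λ ()))
sum-tabulate-one-hot P (Fin.suc i₀) Pi₀≡1 P≡0 =
  cong₂ ℕ._+_ (P≡0 Fin.zero λ ())
              (sum-tabulate-one-hot (P ∘ Fin.suc) i₀ Pi₀≡1 (λ i i≢i₀ → P≡0 (Fin.suc i) (i≢i₀ ∘ Finₚ.suc-injective)))

sum-allFin-one-hot : ∀ {n} (P : Fin n → ℕ) i₀ → P i₀ ≡ 1 → (∀ i → i ≢ i₀ → P i ≡ 0) → sum (map P (allFin n)) ≡ 1
sum-allFin-one-hot P i₀ Pi₀≡1 P≡0 = trans (cong sum (List.map-tabulate (λ i → i) P)) (sum-tabulate-one-hot P i₀ Pi₀≡1 P≡0)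

lookup-injective : ∀ {A : Set} {xs : List A} → Unique xs → ∀ {i j} → lookup xs i ≡ lookup xs j → i ≡ j
lookup-injective {xs = _ ∷ _} _          {Fin.zero}  {Fin.zero}  _  = refl
lookup-injective {xs = _ ∷ _} (x∉xs ∷ _) {Fin.zero}  {Fin.suc j} eq = contradiction eq (All.lookup x∉xs (∈-lookup j))
lookup-injective {xs = _ ∷ _} (x∉xs ∷ _) {Fin.suc i} {Fin.zero}  eq = contradiction (sym eq) (All.lookup x∉xs (∈-lookup i))
lookup-injective {xs = _ ∷ _} (_ ∷ u)    {Fin.suc i} {Fin.suc j} eq = cong Fin.suc (lookup-injective u eq)

IsSimple : {A : Set} → List (A × A) → Set
IsSimple es = Unique es × All (λ e → swap e ∉ es) es

isSimple? : {A : Set} → DecidableEquality A → (es : List (A × A)) → Dec (IsSimple es)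
isSimple? {A} _≟_ es = AllPairs.allPairs? (λ e e′ → ¬? (e ≟ₑ e′)) es ×-dec All.all? (λ e → ¬? (swap e ∈? es)) es
  where
  _≟ₑ_ : DecidableEquality (A × A)
  _≟ₑ_ = ×-≡-dec _≟_ _≟_
  open import Data.List.Membership.DecPropositional _≟ₑ_ using (_∈?_)

-- Congruence modulo m, and the action (i , a) ↦ shift m i a of ℤ on Fin m

module Modular (m : ℕ) .{{_ : NonZero m}} where
  open import Data.Integer using (_+_; _-_)

  -- A record rather than a plain definition, so that a and b can be inferred.
  infix 4 _≡ₘ_
  record _≡ₘ_ (a b : ℤ) : Set where
    constructor ≡ₘ⁺
    field ≡ₘ⁻ : + m ∣ a - b

  ≡ₘ-reflexive : ∀ {a b} → a ≡ b → a ≡ₘ b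
  ≡ₘ-reflexive {a} refl = ≡ₘ⁺ (divides (+ 0) (ℤ.+-inverseʳ a))

  ≡ₘ-sym : ∀ {a b} → a ≡ₘ b → b ≡ₘ a
  ≡ₘ-sym {a} {b} (≡ₘ⁺ m∣a-b) = ≡ₘ⁺ (subst (+ m ∣_) (neg-minus a b) (∣m⇒∣-m m∣a-b))
    where
    neg-minus : ∀ a b → - (a - b) ≡ b - a
    neg-minus = ℤ-Ring.solve-∀

  ≡ₘ-trans : ∀ {a b c} → a ≡ₘ b → b ≡ₘ c → a ≡ₘ c
  ≡ₘ-trans {a} {b} {c} (≡ₘ⁺ m∣a-b) (≡ₘ⁺ m∣b-c) =
    ≡ₘ⁺ (subst (+ m ∣_) (telescope a b c) (∣m∣n⇒∣m+n m∣a-b m∣b-c))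
    where
    telescope : ∀ a b c → (a - b) + (b - c) ≡ a - c
    telescope = ℤ-Ring.solve-∀

  ≡ₘ-setoid : Setoid 0ℓ 0ℓ
  ≡ₘ-setoid = record
    { Carrier       = ℤ
    ; _≈_           = _≡ₘ_
    ; isEquivalence = record { refl = ≡ₘ-reflexive refl ; sym = ≡ₘ-sym ; trans = ≡ₘ-trans }
    }

  +-congˡ-≡ₘ : ∀ a {b c} → b ≡ₘ c → a + b ≡ₘ a + c
  +-congˡ-≡ₘ a {b} {c} (≡ₘ⁺ m∣b-c) = ≡ₘ⁺ (subst (+ m ∣_) (cancel a b c) m∣b-c)
    where
    cancel : ∀ a b c → b - c ≡ (a + b) - (a + c)
    cancel = ℤ-Ring.solve-∀

  +-congʳ-≡ₘ : ∀ {a b} c → a ≡ₘ b → a + c ≡ₘ b + c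
  +-congʳ-≡ₘ {a} {b} c (≡ₘ⁺ m∣a-b) = ≡ₘ⁺ (subst (+ m ∣_) (cancel a b c) m∣a-b)
    where
    cancel : ∀ a b c → a - b ≡ (a + c) - (b + c)
    cancel = ℤ-Ring.solve-∀

  +-multiple-≡ₘ : ∀ a q → a + q ℤ.* + m ≡ₘ a
  +-multiple-≡ₘ a q = ≡ₘ⁺ (divides q (cancel a q (+ m)))
    where
    cancel : ∀ a q m → (a + q ℤ.* m) - a ≡ q ℤ.* m
    cancel = ℤ-Ring.solve-∀

  +-≡ₘ-cancel : ∀ a {b} → a + b ≡ₘ a → + m ∣ b
  +-≡ₘ-cancel a {b} (≡ₘ⁺ m∣a+b-a) = subst (+ m ∣_) (cancel a b) m∣a+b-a
    where
    cancel : ∀ a b → (a + b) - a ≡ b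
    cancel = ℤ-Ring.solve-∀

  ∣∧small⇒≡0 : ∀ {a} → + m ∣ a → ∣ a ∣ < m → a ≡ + 0
  ∣∧small⇒≡0 {a} m∣a ∣a∣<m with ∣ a ∣ in ∣a∣≡
  ... | zero  = ℤ.∣i∣≡0⇒i≡0 ∣a∣≡
  ... | suc _ = contradiction (subst (m ℕᵈ.∣_) ∣a∣≡ (∣⇒∣ᵤ m∣a)) (ℕᵈ.>⇒∤ ∣a∣<m)

  toℤ : Fin m → ℤ
  toℤ i = + toℕ i

  ≡ₘ⇒≡ : ∀ {i j} → toℤ i ≡ₘ toℤ j → i ≡ j
  ≡ₘ⇒≡ {i} {j} (≡ₘ⁺ m∣i-j) =
    Finₚ.toℕ-injective (ℤ.+-injective (ℤ.i-j≡0⇒i≡j _ _ (∣∧small⇒≡0 m∣i-j ∣i-j∣<m)))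
    where
    ∣i-j∣<m : ∣ toℤ i - toℤ j ∣ < m
    ∣i-j∣<m = begin-strict
      ∣ toℤ i - toℤ j ∣        ≡⟨ cong ∣_∣ (ℤ.m-n≡m⊖n (toℕ i) (toℕ j)) ⟩
      ∣ toℕ i ℤ.⊖ toℕ j ∣      ≤⟨ ℤ.∣m⊝n∣≤m⊔n (toℕ i) (toℕ j) ⟩
      toℕ i ℕ.⊔ toℕ j          <⟨ ℕ.⊔-lub (Finₚ.toℕ<n i) (Finₚ.toℕ<n j) ⟩
      m                        ∎
      where open ℕ.≤-Reasoning

  mod-≡ₘ : ∀ n → toℤ (n mod m) ≡ₘ + n
  mod-≡ₘ n rewrite Finₚ.toℕ-fromℕ< (m%n<n n m) =
    ≡ₘ-sym (subst (_≡ₘ + (n % m)) (sym n≡) (+-multiple-≡ₘ (+ (n % m)) (+ (n / m))))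
    where
    n≡ : + n ≡ + (n % m) + + (n / m) ℤ.* + m
    n≡ = begin
      + n                                 ≡⟨ cong +_ (m≡m%n+[m/n]*n n m) ⟩
      + (n % m ℕ.+ n / m * m)             ≡⟨ ℤ.pos-+ (n % m) (n / m * m) ⟩
      + (n % m) + + (n / m * m)           ≡⟨ cong (_+_ (+ (n % m))) (ℤ.pos-* (n / m) m) ⟩
      + (n % m) + + (n / m) ℤ.* + m       ∎
      where open ≡-Reasoning

  %ℕ-≡ₘ : ∀ a → + (a %ℕ m) ≡ₘ a
  %ℕ-≡ₘ a = ≡ₘ-sym (subst (_≡ₘ + (a %ℕ m)) (sym (a≡a%ℕn+[a/ℕn]*n a m)) (+-multiple-≡ₘ (+ (a %ℕ m)) (a /ℕ m)))

  shift-≡ₘ : ∀ i a → toℤ (shift m i a) ≡ₘ toℤ i + a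
  shift-≡ₘ i a = begin
    toℤ (shift m i a)        ≈⟨ mod-≡ₘ (toℕ i ℕ.+ a %ℕ m) ⟩
    + (toℕ i ℕ.+ a %ℕ m)     ≡⟨ ℤ.pos-+ (toℕ i) (a %ℕ m) ⟩
    toℤ i + + (a %ℕ m)       ≈⟨ +-congˡ-≡ₘ (toℤ i) (%ℕ-≡ₘ a) ⟩
    toℤ i + a                ∎
    where open SetoidReasoning ≡ₘ-setoid

  shift-+ : ∀ i a b → shift m (shift m i a) b ≡ shift m i (a + b)
  shift-+ i a b = ≡ₘ⇒≡ (begin
    toℤ (shift m (shift m i a) b)  ≈⟨ shift-≡ₘ (shift m i a) b ⟩
    toℤ (shift m i a) + b          ≈⟨ +-congʳ-≡ₘ b (shift-≡ₘ i a) ⟩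
    toℤ i + a + b                  ≡⟨ ℤ.+-assoc (toℤ i) a b ⟩
    toℤ i + (a + b)                ≈⟨ shift-≡ₘ i (a + b) ⟨
    toℤ (shift m i (a + b))        ∎)
    where open SetoidReasoning ≡ₘ-setoid

  shift-∣ : ∀ i {a} → + m ∣ a → shift m i a ≡ i
  shift-∣ i {a} m∣a = ≡ₘ⇒≡ (begin
    toℤ (shift m i a)  ≈⟨ shift-≡ₘ i a ⟩
    toℤ i + a          ≈⟨ +-congˡ-≡ₘ (toℤ i) (≡ₘ⁺ {a} {+ 0} (subst (+ m ∣_) (sym (ℤ.+-identityʳ a)) m∣a)) ⟩
    toℤ i + + 0        ≡⟨ ℤ.+-identityʳ (toℤ i) ⟩
    toℤ i              ∎)
    where open SetoidReasoning ≡ₘ-setoid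

  shift-zero : ∀ {i} → shift m i (+ 0) ≡ i
  shift-zero = shift-∣ _ (divides (+ 0) refl)

  shift-fixed⇒∣ : ∀ i a → shift m i a ≡ i → + m ∣ a
  shift-fixed⇒∣ i a fixed = +-≡ₘ-cancel (toℤ i) (≡ₘ-sym (subst (λ j → toℤ j ≡ₘ toℤ i + a) fixed (shift-≡ₘ i a)))

  shift-inverseʳ : ∀ i a → shift m (shift m i a) (- a) ≡ i
  shift-inverseʳ i a = trans (shift-+ i a (- a)) (shift-∣ i (divides (+ 0) (ℤ.+-inverseʳ a)))

  shift-inverseˡ : ∀ i a → shift m (shift m i (- a)) a ≡ i
  shift-inverseˡ i a = trans (shift-+ i (- a) a) (shift-∣ i (divides (+ 0) (ℤ.+-inverseˡ a)))

module MultiGraphProperties (H : MultiGraph) where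
  open MultiGraph H

  [≡?]-yes : ∀ {u v} → u ≡ v → [ u ≡? v ] ≡ 1
  [≡?]-yes {u} {v} u≡v with u ≟V v
  ... | yes _   = refl
  ... | no u≢v = contradiction u≡v u≢v

  [≡?]-no : ∀ {u v} → u ≢ v → [ u ≡? v ] ≡ 0
  [≡?]-no {u} {v} u≢v with u ≟V v
  ... | yes u≡v = contradiction u≡v u≢v
  ... | no _    = refl

  module _ {n : ℕ} where
    open Modular (suc n)

    next≡shift : ∀ (j : Fin (suc n)) → next j ≡ shift (suc n) j (+ 1)
    next≡shift j = ≡ₘ⇒≡ (begin
      toℤ (next j)                ≈⟨ mod-≡ₘ (suc (toℕ j)) ⟩
      + suc (toℕ j)               ≡⟨ cong +_ (ℕ.+-comm 1 (toℕ j)) ⟩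
      toℤ j ℤ.+ + 1               ≈⟨ shift-≡ₘ j (+ 1) ⟨
      toℤ (shift (suc n) j (+ 1)) ∎)
      where open SetoidReasoning ≡ₘ-setoid

    next²≢id : 2 ≤ n → ∀ j → next (next j) ≢ j
    next²≢id 2≤n j next²j≡j = ℕ.<⇒≱ (s≤s 2≤n) (ℕᵈ.∣⇒≤ (∣⇒∣ᵤ (shift-fixed⇒∣ j (+ 2) shift-j-2≡j)))
      where
      shift-j-2≡j : shift (suc n) j (+ 2) ≡ j
      shift-j-2≡j = begin
        shift (suc n) j (+ 2)                        ≡⟨ shift-+ j (+ 1) (+ 1) ⟨
        shift (suc n) (shift (suc n) j (+ 1)) (+ 1)  ≡⟨ cong (λ i → shift (suc n) i (+ 1)) (next≡shift j) ⟨
        shift (suc n) (next j) (+ 1)                 ≡⟨ next≡shift (next j) ⟨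
        next (next j)                                ≡⟨ next²j≡j ⟩
        j                                            ∎
        where open ≡-Reasoning

    fold-next≡shift : ∀ j → fold Fin.zero next j ≡ shift (suc n) Fin.zero (+ j)
    fold-next≡shift zero    = sym shift-zero
    fold-next≡shift (suc j) = begin
      next (fold Fin.zero next j)                          ≡⟨ cong next (fold-next≡shift j) ⟩
      next (shift (suc n) Fin.zero (+ j))                  ≡⟨ next≡shift _ ⟩
      shift (suc n) (shift (suc n) Fin.zero (+ j)) (+ 1)   ≡⟨ shift-+ Fin.zero (+ j) (+ 1) ⟩
      shift (suc n) Fin.zero (+ (j ℕ.+ 1))                 ≡⟨ cong (λ t → shift (suc n) Fin.zero (+ t)) (ℕ.+-comm j 1) ⟩
      shift (suc n) Fin.zero (+ suc j)                     ∎
      where open ≡-Reasoning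

    fold-next-period : fold Fin.zero next (suc n) ≡ Fin.zero
    fold-next-period = trans (fold-next≡shift (suc n)) (shift-∣ Fin.zero ∣-refl)

  joins-sym : ∀ {e u v} → Joins e u v → Joins e v u
  joins-sym (inj₁ uv) = inj₂ uv
  joins-sym (inj₂ vu) = inj₁ vu

  joins⇒ends : ∀ {e u v} → Joins e u v → ends e ≡ (u , v) ⊎ ends e ≡ (v , u)
  joins⇒ends (inj₁ (refl , refl)) = inj₁ refl
  joins⇒ends (inj₂ (refl , refl)) = inj₂ refl

  joins-same : ∀ {e a b c d} → Joins e a b → Joins e c d → (a ≡ c × b ≡ d) ⊎ (a ≡ d × b ≡ c)
  joins-same (inj₁ (refl , refl)) (inj₁ (refl , refl)) = inj₁ (refl , refl)
  joins-same (inj₁ (refl , refl)) (inj₂ (refl , refl)) = inj₂ (refl , refl)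
  joins-same (inj₂ (refl , refl)) (inj₁ (refl , refl)) = inj₂ (refl , refl)
  joins-same (inj₂ (refl , refl)) (inj₂ (refl , refl)) = inj₁ (refl , refl)

  edge-joining : ∀ {u v} → (u , v) ∈ edges ⊎ (v , u) ∈ edges → Σ[ e ∈ Edge ] Joins e u v
  edge-joining (inj₁ uv∈) = Any.index uv∈ , inj₁ (cong proj₁ (sym (lookup-index uv∈)) , cong proj₂ (sym (lookup-index uv∈)))
  edge-joining (inj₂ vu∈) = Any.index vu∈ , inj₂ (cong proj₁ (sym (lookup-index vu∈)) , cong proj₂ (sym (lookup-index vu∈)))

  module _ (simple : IsSimple edges) where

    reverse∉ : ∀ e → swap (ends e) ∉ edges
    reverse∉ e = All.lookup (proj₂ simple) (∈-lookup e)

    simple⇒loopless : ∀ {e u} → ¬ Joins e u u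
    simple⇒loopless {e} {u} u-u = reverse∉ e (subst (_∈ edges) (trans loop (cong swap (sym loop))) (∈-lookup e))
      where
      loop : ends e ≡ (u , u)
      loop = reduce (joins⇒ends u-u)

    simple⇒joins-injective : ∀ {e₁ e₂ u v} → Joins e₁ u v → Joins e₂ u v → e₁ ≡ e₂
    simple⇒joins-injective {e₁} {e₂} j₁ j₂ with joins⇒ends j₁ | joins⇒ends j₂
    ... | inj₁ p | inj₁ q = lookup-injective (proj₁ simple) (trans p (sym q))
    ... | inj₂ p | inj₂ q = lookup-injective (proj₁ simple) (trans p (sym q))
    ... | inj₁ p | inj₂ q = contradiction (subst (_∈ edges) (trans q (cong swap (sym p))) (∈-lookup e₂)) (reverse∉ e₁)
    ... | inj₂ p | inj₁ q = contradiction (subst (_∈ edges) (trans q (cong swap (sym p))) (∈-lookup e₂)) (reverse∉ e₁)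

    simple⇒3≤length : ∀ {k} → HasCycle k → 3 ≤ k
    simple⇒3≤length {1} (_ , _ , _ , _ , joins) = contradiction (joins Fin.zero) simple⇒loopless
    simple⇒3≤length {2} (_ , _ , _ , g-inj , joins)
      with g-inj (simple⇒joins-injective (joins Fin.zero) (joins-sym (joins (Fin.suc Fin.zero))))
    ... | ()
    simple⇒3≤length {suc (suc (suc _))} _ = s≤s (s≤s (s≤s z≤n))

  cycle⁺ : ∀ {n} → 2 ≤ n → (f : Fin (suc n) → Vtx) → Injective _≡_ _≡_ f →
           (∀ j → (f j , f (next j)) ∈ edges ⊎ (f (next j) , f j) ∈ edges) → HasCycle (suc n)
  cycle⁺ {n} 2≤n f f-inj adjacent = f , g , f-inj , g-inj , proj₂ ∘ edge-joining ∘ adjacent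
    where
    g : Fin (suc n) → Edge
    g = proj₁ ∘ edge-joining ∘ adjacent

    g-inj : Injective _≡_ _≡_ g
    g-inj {i} {j} gi≡gj
      with joins-same (proj₂ (edge-joining (adjacent i)))
                      (subst (λ e → Joins e (f j) (f (next j))) (sym gi≡gj) (proj₂ (edge-joining (adjacent j))))
    ... | inj₁ (fi≡fj , _)         = f-inj fi≡fj
    ... | inj₂ (fi≡fnj , fni≡fj) = contradiction (trans (cong next (sym (f-inj fi≡fnj))) (f-inj fni≡fj)) (next²≢id 2≤n j)

[≡?]-cong : ∀ (H H′ : MultiGraph) {u v u′ v′} → (u ≡ v → u′ ≡ v′) → (u′ ≡ v′ → u ≡ v) →
            MultiGraph.[_≡?_] H u v ≡ MultiGraph.[_≡?_] H′ u′ v′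
[≡?]-cong H H′ {u} {v} to from with MultiGraph._≟V_ H u v
... | yes u≡v = sym (MultiGraphProperties.[≡?]-yes H′ (to u≡v))
... | no u≢v  = sym (MultiGraphProperties.[≡?]-no H′ (u≢v ∘ from))

-- Voltage graphs and their derived graphs

module _ (G : VoltageGraph) where
  open VoltageGraph G

  Link : Set
  Link = (Fin nV × Fin nV × ℤ) ⊎ (Fin nP × Fin nV)

  link-≟ : DecidableEquality Link
  link-≟ = ⊎-≡-dec (×-≡-dec Finₚ._≟_ (×-≡-dec Finₚ._≟_ ℤ._≟_)) (×-≡-dec Finₚ._≟_ Finₚ._≟_)

  links : List Link
  links = map inj₁ arcs ++ map inj₂ pins

  linkEnds : Link → (Fin nV ⊎ Fin nP) × (Fin nV ⊎ Fin nP)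
  linkEnds (inj₁ (v , w , _)) = inj₁ v , inj₁ w
  linkEnds (inj₂ (p , w))     = inj₂ p , inj₁ w

  linkVoltage : Link → ℤ
  linkVoltage (inj₁ (_ , _ , a)) = a
  linkVoltage (inj₂ _)           = + 0

  BaseGraph : MultiGraph
  BaseGraph = record
    { Vtx   = Fin nV ⊎ Fin nP
    ; _≟V_  = ⊎-≡-dec Finₚ._≟_ Finₚ._≟_
    ; vtxs  = map inj₁ (allFin nV) ++ map inj₂ (allFin nP)
    ; edges = map linkEnds links
    }

  open MultiGraph BaseGraph using () renaming (Vtx to Base)

  data Dart (s t : Base) (a : ℤ) : Set where
    forward  : ∀ {ℓ} → ℓ ∈ links → linkEnds ℓ ≡ (s , t) → linkVoltage ℓ ≡ a → Dart s t a
    backward : ∀ {ℓ} → ℓ ∈ links → linkEnds ℓ ≡ (t , s) → - linkVoltage ℓ ≡ a → Dart s t a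

  module _ (simple : IsSimple (map linkEnds links)) where

    private
      same-link : ∀ {ℓ ℓ′} → ℓ ∈ links → ℓ′ ∈ links → linkEnds ℓ ≡ linkEnds ℓ′ → ℓ ≡ ℓ′
      same-link = unique-map⇒injective (proj₁ simple)

      no-reverse-link : ∀ {ℓ ℓ′} → ℓ ∈ links → ℓ′ ∈ links → linkEnds ℓ′ ≢ swap (linkEnds ℓ)
      no-reverse-link ℓ∈ ℓ′∈ reversed =
        All.lookup (proj₂ simple) (∈-map⁺ linkEnds ℓ∈) (subst (_∈ map linkEnds links) reversed (∈-map⁺ linkEnds ℓ′∈))

    dart-functional : ∀ {s t a b} → Dart s t a → Dart s t b → a ≡ b
    dart-functional (forward ℓ∈ e v) (forward ℓ′∈ e′ v′)
      rewrite same-link ℓ∈ ℓ′∈ (trans e (sym e′)) = trans (sym v) v′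
    dart-functional (backward ℓ∈ e v) (backward ℓ′∈ e′ v′)
      rewrite same-link ℓ∈ ℓ′∈ (trans e (sym e′)) = trans (sym v) v′
    dart-functional (forward ℓ∈ e _) (backward ℓ′∈ e′ _) =
      contradiction (trans e′ (cong swap (sym e))) (no-reverse-link ℓ∈ ℓ′∈)
    dart-functional (backward ℓ∈ e _) (forward ℓ′∈ e′ _) =
      contradiction (trans e′ (cong swap (sym e))) (no-reverse-link ℓ∈ ℓ′∈)

module DerivedGraph (G : VoltageGraph) (m : ℕ) .{{_ : NonZero m}} where
  open VoltageGraph G
  open MultiGraph (Derived G m)
  open MultiGraphProperties (Derived G m)
  open Modular m
  open import Data.Nat using (_+_)
  module B = MultiGraph (BaseGraph G)
  open import Data.List.Membership.DecPropositional (link-≟ G) using (_∈?_)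

  proj : Vtx → B.Vtx
  proj (inj₁ (v , _)) = inj₁ v
  proj (inj₂ p)       = inj₂ p

  projEnds : Vtx × Vtx → B.Vtx × B.Vtx
  projEnds (u , v) = proj u , proj v

  liftAt : Link G → Fin m → Vtx × Vtx
  liftAt (inj₁ (v , w , a)) i = inj₁ (v , i) , inj₁ (w , shift m i a)
  liftAt (inj₂ (p , w))     i = inj₂ p , inj₁ (w , i)

  lift : Link G → List (Vtx × Vtx)
  lift ℓ = map (liftAt ℓ) (allFin m)

  projEnds-liftAt : ∀ ℓ i → projEnds (liftAt ℓ i) ≡ linkEnds G ℓ
  projEnds-liftAt (inj₁ _) _ = refl
  projEnds-liftAt (inj₂ _) _ = refl

  edges≡ : edges ≡ concatMap lift (links G)
  edges≡ = begin
    concatMap (lift ∘ inj₁) arcs ++ concatMap (lift ∘ inj₂) pins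
      ≡⟨ cong₂ _++_ (List.concatMap-map lift inj₁ arcs) (List.concatMap-map lift inj₂ pins) ⟨
    concatMap lift (map inj₁ arcs) ++ concatMap lift (map inj₂ pins)
      ≡⟨ List.concatMap-++ lift (map inj₁ arcs) (map inj₂ pins) ⟨
    concatMap lift (links G)
      ∎
    where open ≡-Reasoning

  ∈-edges⁺ : ∀ {ℓ} → ℓ ∈ links G → ∀ i → liftAt ℓ i ∈ edges
  ∈-edges⁺ {ℓ} ℓ∈ i =
    subst (liftAt ℓ i ∈_) (sym edges≡) (∈-concatMap⁺ lift (Any.map (λ { refl → ∈-map⁺ (liftAt ℓ) (∈-allFin i) }) ℓ∈))

  ∈-edges⁻ : ∀ {e} → e ∈ edges → Σ[ ℓ ∈ Link G ] ℓ ∈ links G × Σ[ i ∈ Fin m ] e ≡ liftAt ℓ i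
  ∈-edges⁻ {e} e∈ with find (∈-concatMap⁻ lift (subst (e ∈_) edges≡ e∈))
  ... | ℓ , ℓ∈ , e∈lift with ∈-map⁻ (liftAt ℓ) e∈lift
  ... | i , _ , e≡ = ℓ , ℓ∈ , i , e≡

  derived-simple : IsSimple B.edges → IsSimple edges
  derived-simple (base-unique , base-no-reverse) = unique , All.tabulate no-reverse
    where
    lift-unique : ∀ ℓ → Unique (lift ℓ)
    lift-unique (inj₁ _) = Unique.map⁺ (λ { refl → refl }) (Unique.allFin⁺ m)
    lift-unique (inj₂ _) = Unique.map⁺ (λ { refl → refl }) (Unique.allFin⁺ m)

    lift-ends : ∀ {ℓ e} → e ∈ lift ℓ → projEnds e ≡ linkEnds G ℓ
    lift-ends {ℓ} e∈ with ∈-map⁻ (liftAt ℓ) e∈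
    ... | i , _ , refl = projEnds-liftAt ℓ i

    unique : Unique edges
    unique = subst Unique (sym edges≡) (unique-concatMap lift-ends lift-unique base-unique)

    base-∈ : ∀ {e} → e ∈ edges → projEnds e ∈ B.edges
    base-∈ e∈ with ∈-edges⁻ e∈
    ... | ℓ , ℓ∈ , i , refl = subst (_∈ B.edges) (sym (projEnds-liftAt ℓ i)) (∈-map⁺ (linkEnds G) ℓ∈)

    no-reverse : ∀ {e} → e ∈ edges → swap e ∉ edges
    no-reverse e∈ swap-e∈ = All.lookup base-no-reverse (base-∈ e∈) (base-∈ swap-e∈)

  Lifts : ℤ → Vtx → Vtx → Set
  Lifts a (inj₁ (_ , i)) (inj₁ (_ , j)) = j ≡ shift m i a
  Lifts _ _              _              = ⊤

  Step : Vtx → Vtx → Set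
  Step u v = Σ[ a ∈ ℤ ] Dart G (proj u) (proj v) a × Lifts a u v

  edge⇒steps : ∀ {u v} → (u , v) ∈ edges → Step u v × Step v u
  edge⇒steps uv∈ with ∈-edges⁻ uv∈
  ... | inj₁ (_ , _ , a) , ℓ∈ , i , refl =
    (a , forward ℓ∈ refl refl , refl) , (- a , backward ℓ∈ refl refl , sym (shift-inverseʳ i a))
  ... | inj₂ _ , ℓ∈ , _ , refl =
    (+ 0 , forward ℓ∈ refl refl , tt) , (- + 0 , backward ℓ∈ refl refl , tt)

  joins⇒step : ∀ {e u v} → Joins e u v → Step u v
  joins⇒step {e} j with joins⇒ends j
  ... | inj₁ ends≡uv = proj₁ (edge⇒steps (subst (_∈ edges) ends≡uv (∈-lookup e)))
  ... | inj₂ ends≡vu = proj₂ (edge⇒steps (subst (_∈ edges) ends≡vu (∈-lookup e)))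

  lifted-steps-injective : IsSimple B.edges → ∀ {x l u v} → Step (inj₁ (x , l)) u → Step (inj₁ (x , l)) v →
                           proj u ≡ proj v → u ≡ v
  lifted-steps-injective _ {u = inj₂ _} {inj₂ _} _ _ refl = refl
  lifted-steps-injective simple {u = inj₁ _} {inj₁ _} (_ , dart-a , refl) (_ , dart-b , refl) refl =
    cong (λ c → inj₁ (_ , shift m _ c)) (dart-functional G simple dart-a dart-b)

  incidence : Vtx → Vtx × Vtx → ℕ
  incidence v (a , b) = [ a ≡? v ] + [ b ≡? v ]

  base-incidence : B.Vtx → B.Vtx × B.Vtx → ℕ
  base-incidence x (a , b) = B.[ a ≡? x ] + B.[ b ≡? x ]

  count-lifts : ∀ x u j (σ : Fin m → Fin m) i₀ → σ i₀ ≡ j → (∀ i → σ i ≡ j → i ≡ i₀) →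
                sum (map (λ i → [ inj₁ (x , σ i) ≡? inj₁ (u , j) ]) (allFin m)) ≡ B.[ inj₁ x ≡? inj₁ u ]
  count-lifts x u j σ i₀ σi₀≡j σi≡j⇒i≡i₀ = by-cases (x Finₚ.≟ u)
    where
    by-cases : Dec (x ≡ u) → sum (map (λ i → [ inj₁ (x , σ i) ≡? inj₁ (u , j) ]) (allFin m)) ≡ B.[ inj₁ x ≡? inj₁ u ]
    by-cases (no x≢u) =
      trans (sum-map-zero (λ i → [≡?]-no {inj₁ (x , σ i)} {inj₁ (u , j)} λ { refl → x≢u refl }) (allFin m))
            (sym (MultiGraphProperties.[≡?]-no (BaseGraph G) {inj₁ x} {inj₁ u} λ { refl → x≢u refl }))
    by-cases (yes refl) =
      trans (sum-allFin-one-hot _ i₀ ([≡?]-yes (cong (λ i → inj₁ (x , i)) σi₀≡j))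
                                     (λ i i≢i₀ → [≡?]-no λ { refl → i≢i₀ (σi≡j⇒i≡i₀ i refl) }))
            (sym (MultiGraphProperties.[≡?]-yes (BaseGraph G) refl))

  lift-incidence : ∀ u j ℓ → sum (map (incidence (inj₁ (u , j))) (lift ℓ)) ≡ base-incidence (inj₁ u) (linkEnds G ℓ)
  lift-incidence u j ℓ = trans (cong sum (sym (List.map-∘ (allFin m)))) (per-link ℓ)
    where
    per-link : ∀ ℓ → sum (map (incidence (inj₁ (u , j)) ∘ liftAt ℓ) (allFin m)) ≡ base-incidence (inj₁ u) (linkEnds G ℓ)
    per-link (inj₁ (x , y , a)) = trans (sum-map-+ _ _ (allFin m))
      (cong₂ _+_ (count-lifts x u j (λ i → i) j refl (λ _ i≡j → i≡j))
                 (count-lifts y u j (λ i → shift m i a) (shift m j (- a)) (shift-inverseˡ j a)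
                              (λ i i+a≡j → trans (sym (shift-inverseʳ i a)) (cong (λ k → shift m k (- a)) i+a≡j))))
    per-link (inj₂ (_ , w)) = count-lifts w u j (λ i → i) j refl (λ _ i≡j → i≡j)

  pinned-incidence : ∀ q ℓ → sum (map (incidence (inj₂ q)) (lift ℓ)) ≡ m * base-incidence (inj₂ q) (linkEnds G ℓ)
  pinned-incidence q ℓ = trans (cong sum (sym (List.map-∘ (allFin m)))) (per-link ℓ)
    where
    per-link : ∀ ℓ → sum (map (incidence (inj₂ q) ∘ liftAt ℓ) (allFin m)) ≡ m * base-incidence (inj₂ q) (linkEnds G ℓ)
    per-link (inj₁ _)       = trans (sum-map-zero (λ _ → refl) (allFin m)) (sym (ℕ.*-zeroʳ m))
    per-link (inj₂ (p , _)) = begin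
      sum (map (λ _ → [ inj₂ p ≡? inj₂ q ] + 0) (allFin m))  ≡⟨ sum-map-const _ (allFin m) ⟩
      length (allFin m) * ([ inj₂ p ≡? inj₂ q ] + 0)
        ≡⟨ cong₂ _*_ (List.length-tabulate {n = m} (λ i → i)) (cong (_+ 0) same-indicator) ⟩
      m * (B.[ inj₂ p ≡? inj₂ q ] + 0)                      ∎
      where
      open ≡-Reasoning
      same-indicator : [ inj₂ p ≡? inj₂ q ] ≡ B.[ inj₂ p ≡? inj₂ q ]
      same-indicator = [≡?]-cong (Derived G m) (BaseGraph G) (λ { refl → refl }) (λ { refl → refl })

  deg-lift : ∀ u j → deg (inj₁ (u , j)) ≡ B.deg (inj₁ u)
  deg-lift u j = begin
    sum (map (incidence (inj₁ (u , j))) edges)                                ≡⟨ cong (sum ∘ map _) edges≡ ⟩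
    sum (map (incidence (inj₁ (u , j))) (concatMap lift (links G)))            ≡⟨ sum-map-concatMap _ lift (links G) ⟩
    sum (map (λ ℓ → sum (map (incidence (inj₁ (u , j))) (lift ℓ))) (links G)) ≡⟨ sum-map-cong (lift-incidence u j) (links G) ⟩
    sum (map (base-incidence (inj₁ u) ∘ linkEnds G) (links G))                 ≡⟨ cong sum (List.map-∘ (links G)) ⟩
    B.deg (inj₁ u)                                                            ∎
    where open ≡-Reasoning

  deg-pinned : ∀ q → deg (inj₂ q) ≡ m * B.deg (inj₂ q)
  deg-pinned q = begin
    sum (map (incidence (inj₂ q)) edges)                                      ≡⟨ cong (sum ∘ map _) edges≡ ⟩
    sum (map (incidence (inj₂ q)) (concatMap lift (links G)))                  ≡⟨ sum-map-concatMap _ lift (links G) ⟩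
    sum (map (λ ℓ → sum (map (incidence (inj₂ q)) (lift ℓ))) (links G))       ≡⟨ sum-map-cong (pinned-incidence q) (links G) ⟩
    sum (map (λ ℓ → m * base-incidence (inj₂ q) (linkEnds G ℓ)) (links G))     ≡⟨ sum-map-* m _ (links G) ⟩
    m * sum (map (base-incidence (inj₂ q) ∘ linkEnds G) (links G))             ≡⟨ cong (λ xs → m * sum xs) (List.map-∘ (links G)) ⟩
    m * B.deg (inj₂ q)                                                        ∎
    where open ≡-Reasoning

  length-allPairs : length (allPairs nV m) ≡ nV * m
  length-allPairs =
    trans (length-concatMap _ (λ v → trans (List.length-map (v ,_) (allFin m)) (List.length-tabulate {n = m} (λ i → i))) (allFin nV))
          (cong (_* m) (List.length-tabulate {n = nV} (λ i → i)))

  count-degrees : ∀ {d e} → d ≢ e → (∀ u j → deg (inj₁ (u , j)) ≡ d) → (∀ q → deg (inj₂ q) ≡ e) →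
                  #deg d ≡ nV * m × #deg e ≡ nP
  count-degrees {d} {e} d≢e lifted pinned = #deg-lifted , #deg-pinned
    where
    liftedVtxs pinnedVtxs : List Vtx
    liftedVtxs = map inj₁ (allPairs nV m)
    pinnedVtxs = map inj₂ (allFin nP)

    has? : ∀ c → (v : Vtx) → Dec (deg v ≡ c)
    has? c v = deg v ℕ.≟ c

    #deg-split : ∀ c → #deg c ≡ length (filter (has? c) liftedVtxs) + length (filter (has? c) pinnedVtxs)
    #deg-split c = trans (cong length (List.filter-++ (has? c) liftedVtxs pinnedVtxs))
                         (List.length-++ (filter (has? c) liftedVtxs))

    lifted-d : All (λ v → deg v ≡ d) liftedVtxs
    lifted-d = All.map⁺ (All.universal (λ (u , j) → lifted u j) (allPairs nV m))

    pinned-e : All (λ v → deg v ≡ e) pinnedVtxs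
    pinned-e = All.map⁺ (All.universal pinned (allFin nP))

    other : ∀ {c c′ v} → c ≢ c′ → deg v ≡ c → deg v ≢ c′
    other c≢c′ deg≡c deg≡c′ = c≢c′ (trans (sym deg≡c) deg≡c′)

    #deg-lifted : #deg d ≡ nV * m
    #deg-lifted = begin
      #deg d                                  ≡⟨ #deg-split d ⟩
      length (filter (has? d) liftedVtxs) + length (filter (has? d) pinnedVtxs)
        ≡⟨ cong₂ (λ xs ys → length xs + length ys) (List.filter-all (has? d) lifted-d)
                                                   (List.filter-none (has? d) (All.map (other (d≢e ∘ sym)) pinned-e)) ⟩
      length liftedVtxs + 0                   ≡⟨ ℕ.+-identityʳ _ ⟩
      length liftedVtxs                       ≡⟨ List.length-map inj₁ (allPairs nV m) ⟩
      length (allPairs nV m)                  ≡⟨ length-allPairs ⟩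
      nV * m                                  ∎
      where open ≡-Reasoning

    #deg-pinned : #deg e ≡ nP
    #deg-pinned = begin
      #deg e                                  ≡⟨ #deg-split e ⟩
      length (filter (has? e) liftedVtxs) + length (filter (has? e) pinnedVtxs)
        ≡⟨ cong₂ (λ xs ys → length xs + length ys) (List.filter-none (has? e) (All.map (other d≢e) lifted-d))
                                                   (List.filter-all (has? e) pinned-e) ⟩
      length pinnedVtxs                       ≡⟨ List.length-map inj₂ (allFin nP) ⟩
      length (allFin nP)                      ≡⟨ List.length-tabulate {n = nP} (λ i → i) ⟩
      nP                                      ∎
      where open ≡-Reasoning

  ZeroLift : Vtx → Vtx → Set
  ZeroLift (inj₁ (x , i)) (inj₁ (y , j)) = i ≡ j × (inj₁ (x , y , + 0) ∈ links G ⊎ inj₁ (y , x , + 0) ∈ links G)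
  ZeroLift (inj₂ p)       (inj₁ (y , _)) = inj₂ (p , y) ∈ links G
  ZeroLift (inj₁ (y , _)) (inj₂ p)       = inj₂ (p , y) ∈ links G
  ZeroLift (inj₂ _)       (inj₂ _)       = ⊥

  zeroLift? : ∀ u v → Dec (ZeroLift u v)
  zeroLift? (inj₁ (x , i)) (inj₁ (y , j)) =
    (i Finₚ.≟ j) ×-dec ((inj₁ (x , y , + 0) ∈? links G) ⊎-dec (inj₁ (y , x , + 0) ∈? links G))
  zeroLift? (inj₂ p)       (inj₁ (y , _)) = inj₂ (p , y) ∈? links G
  zeroLift? (inj₁ (y , _)) (inj₂ p)       = inj₂ (p , y) ∈? links G
  zeroLift? (inj₂ _)       (inj₂ _)       = no λ ()

  zeroLift⇒adjacent : ∀ {u v} → ZeroLift u v → (u , v) ∈ edges ⊎ (v , u) ∈ edges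
  zeroLift⇒adjacent {inj₁ (x , i)} {inj₁ _} (refl , inj₁ xy∈) =
    inj₁ (subst (λ j → (inj₁ (x , i) , inj₁ (_ , j)) ∈ edges) shift-zero (∈-edges⁺ xy∈ i))
  zeroLift⇒adjacent {inj₁ (x , i)} {inj₁ _} (refl , inj₂ yx∈) =
    inj₂ (subst (λ j → (inj₁ (_ , i) , inj₁ (x , j)) ∈ edges) shift-zero (∈-edges⁺ yx∈ i))
  zeroLift⇒adjacent {inj₂ _} {inj₁ (_ , i)} py∈ = inj₁ (∈-edges⁺ py∈ i)
  zeroLift⇒adjacent {inj₁ (_ , i)} {inj₂ _} py∈ = inj₂ (∈-edges⁺ py∈ i)

-- A certified search through short closed walks

T-not⇒¬T : ∀ {b} → T (not b) → ¬ T b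
T-not⇒¬T {true} ()

module ClosedWalkSearch (adj : ℕ → List (ℕ × ℤ)) (pinned : ℕ → Bool) (M : ℕ) where
  open import Data.Integer using (_+_)

  acceptable : Bool → ℤ → Bool
  acceptable p s = not p ∧ (0 <ᵇ ∣ s ∣) ∧ (∣ s ∣ <ᵇ M)

  backtracks : ℕ → ℕ → ℕ → Bool
  backtracks u v w = not (pinned v) ∧ (w ≡ᵇ u)

  -- explore budget b₀ b₁ prev cur s p checks every extension, by at most budget steps, of a
  -- walk b₀ b₁ … prev cur of net voltage s that has visited a pinned vertex iff p.  An
  -- extension may never step straight back from an unpinned vertex, and whenever it returns
  -- to b₀, the closed walk must be acceptable unless closing it turns back at b₀.
  explore : ℕ → (b₀ b₁ prev cur : ℕ) → ℤ → Bool → Bool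
  explore zero         _  _  _    _   _ _ = true
  explore (suc budget) b₀ b₁ prev cur s p = all continue (adj cur)
    where
    continue : ℕ × ℤ → Bool
    continue (w , a) = backtracks prev cur w
      ∨ ((not (w ≡ᵇ b₀) ∨ backtracks cur b₀ b₁ ∨ acceptable (p ∨ pinned w) (s + a))
         ∧ explore budget b₀ b₁ cur w (s + a) (p ∨ pinned w))

  closedWalksAcceptable : (N budget : ℕ) → Bool
  closedWalksAcceptable N budget =
    all (λ b₀ → all (λ (b₁ , a) → explore budget b₀ b₁ b₀ b₁ a (pinned b₀ ∨ pinned b₁)) (adj b₀)) (downFrom N)

  acceptable-sound : ∀ {p s} → T (acceptable p s) → ¬ T p × 0 < ∣ s ∣ × ∣ s ∣ < M
  acceptable-sound {p} {s} ok with Equivalence.to Bool.T-∧ ok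
  ... | not-p , bounds with Equivalence.to Bool.T-∧ bounds
  ... | 0<s , s<M = T-not⇒¬T not-p , ℕ.<ᵇ⇒< 0 (∣ s ∣) 0<s , ℕ.<ᵇ⇒< (∣ s ∣) M s<M

  module Walk (B : ℕ → ℕ) (a : ℕ → ℤ)
              (steps : ∀ j → (B (suc j) , a j) ∈ adj (B j))
              (reduced : ∀ j → ¬ T (backtracks (B j) (B (suc j)) (B (suc (suc j))))) where

    voltage : ℕ → ℤ
    voltage zero    = a 0
    voltage (suc j) = voltage j + a (suc j)

    visitsPinned : ℕ → Bool
    visitsPinned zero    = pinned (B 0) ∨ pinned (B 1)
    visitsPinned (suc j) = visitsPinned j ∨ pinned (B (suc (suc j)))

    unpinned-upto : ∀ n → ¬ T (visitsPinned n) → ∀ i → i ≤ suc n → ¬ T (pinned (B i))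
    unpinned-upto zero    unvisited zero          _ = unvisited ∘ Equivalence.from Bool.T-∨ ∘ inj₁
    unpinned-upto zero    unvisited (suc zero)    _ = unvisited ∘ Equivalence.from Bool.T-∨ ∘ inj₂
    unpinned-upto zero    _         (suc (suc _)) (s≤s ())
    unpinned-upto (suc n) unvisited i i≤n+2 with ℕ.m≤n⇒m<n∨m≡n i≤n+2
    ... | inj₁ (s≤s i≤n+1) = unpinned-upto n (unvisited ∘ Equivalence.from Bool.T-∨ ∘ inj₁) i i≤n+1
    ... | inj₂ refl        = unvisited ∘ Equivalence.from Bool.T-∨ ∘ inj₂

    module _ {n} (closes₀ : B (suc n) ≡ B 0) (closes₁ : B (suc (suc n)) ≡ B 1) where

      closing-sound : T (not (B (suc n) ≡ᵇ B 0) ∨ backtracks (B n) (B 0) (B 1) ∨ acceptable (visitsPinned n) (voltage n)) →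
                      T (acceptable (visitsPinned n) (voltage n))
      closing-sound closing with Equivalence.to Bool.T-∨ closing
      ... | inj₁ not-closed = contradiction (ℕ.≡⇒≡ᵇ _ _ closes₀) (T-not⇒¬T not-closed)
      ... | inj₂ closing′ with Equivalence.to Bool.T-∨ closing′
      ... | inj₁ backtrack =
        contradiction (subst₂ (λ b₀ b₁ → T (backtracks (B n) b₀ b₁)) (sym closes₀) (sym closes₁) backtrack) (reduced n)
      ... | inj₂ ok        = ok

      explore-sound : ∀ j budget → j < n → n ≤ j ℕ.+ budget →
                      T (explore budget (B 0) (B 1) (B j) (B (suc j)) (voltage j) (visitsPinned j)) →
                      T (acceptable (visitsPinned n) (voltage n))
      explore-sound j zero j<n n≤j _ = contradiction (subst (n ≤_) (ℕ.+-identityʳ j) n≤j) (ℕ.<⇒≱ j<n)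
      explore-sound j (suc budget) j<n n≤j+budget explored
        with Equivalence.to Bool.T-∨ (All.lookup (All.all⁺ _ _ explored) (steps (suc j)))
      ... | inj₁ backtrack = contradiction backtrack (reduced j)
      ... | inj₂ continue with Equivalence.to Bool.T-∧ continue | ℕ.m≤n⇒m<n∨m≡n j<n
      ... | _ , explored′ | inj₁ j+1<n = explore-sound (suc j) budget j+1<n (subst (n ≤_) (ℕ.+-suc j budget) n≤j+budget) explored′
      ... | closing , _   | inj₂ refl  = closing-sound closing

      closed-walk-acceptable : ∀ {N budget} → closedWalksAcceptable N budget ≡ true → B 0 < N → 1 ≤ n → n ≤ budget →
                               T (acceptable (visitsPinned n) (voltage n))
      closed-walk-acceptable {budget = budget} searched B₀<N 1≤n n≤budget = explore-sound 0 budget 1≤n n≤budget explored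
        where
        explored : T (explore budget (B 0) (B 1) (B 0) (B 1) (voltage 0) (visitsPinned 0))
        explored = All.lookup (All.all⁺ _ _ (All.lookup (All.all⁺ _ _ (Equivalence.from Bool.T-≡ searched)) (∈-downFrom⁺ B₀<N)))
                              (steps 0)

-- The girth of a derived graph, from a search in the voltage graph

module Encoding (G : VoltageGraph) where
  open VoltageGraph G
  open MultiGraph (BaseGraph G) using () renaming (Vtx to Base)
  open import Data.Nat using (_+_)

  code : Base → ℕ
  code (inj₁ v) = toℕ v
  code (inj₂ p) = nV + toℕ p

  pinned : ℕ → Bool
  pinned c = nV ≤ᵇ c

  code-injective : ∀ {x y} → code x ≡ code y → x ≡ y
  code-injective {inj₁ _} {inj₁ _} eq = cong inj₁ (Finₚ.toℕ-injective eq)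
  code-injective {inj₂ _} {inj₂ _} eq = cong inj₂ (Finₚ.toℕ-injective (ℕ.+-cancelˡ-≡ nV _ _ eq))
  code-injective {inj₁ v} {inj₂ _} eq = contradiction (subst (_< nV) eq (Finₚ.toℕ<n v)) (ℕ.≤⇒≯ (ℕ.m≤m+n nV _))
  code-injective {inj₂ _} {inj₁ w} eq = contradiction (subst (_< nV) (sym eq) (Finₚ.toℕ<n w)) (ℕ.≤⇒≯ (ℕ.m≤m+n nV _))

  code< : ∀ x → code x < nV + nP
  code< (inj₁ v) = ℕ.<-≤-trans (Finₚ.toℕ<n v) (ℕ.m≤m+n nV nP)
  code< (inj₂ p) = ℕ.+-monoʳ-< nV (Finₚ.toℕ<n p)

  pinned-code : ∀ p → T (pinned (code (inj₂ p)))
  pinned-code p = ℕ.≤⇒≤ᵇ (ℕ.m≤m+n nV (toℕ p))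

  TableCovers : (ℕ → List (ℕ × ℤ)) → Set
  TableCovers adj = All (λ ℓ → (code (proj₂ (linkEnds G ℓ)) , linkVoltage G ℓ) ∈ adj (code (proj₁ (linkEnds G ℓ)))
                             × (code (proj₁ (linkEnds G ℓ)) , - linkVoltage G ℓ) ∈ adj (code (proj₂ (linkEnds G ℓ))))
                        (links G)

  tableCovers? : ∀ adj → Dec (TableCovers adj)
  tableCovers? adj = All.all? (λ ℓ → (_ ∈? adj _) ×-dec (_ ∈? adj _)) (links G)
    where open import Data.List.Membership.DecPropositional (×-≡-dec ℕ._≟_ ℤ._≟_) using (_∈?_)

  ClosedWalksAcceptable : (ℕ → List (ℕ × ℤ)) → (M budget : ℕ) → Set
  ClosedWalksAcceptable adj M budget = ClosedWalkSearch.closedWalksAcceptable adj pinned M (nV + nP) budget ≡ true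

module GirthLowerBound (G : VoltageGraph) (m : ℕ) .{{_ : NonZero m}} where
  open VoltageGraph G
  open MultiGraph (Derived G m)
  open MultiGraphProperties (Derived G m)
  open DerivedGraph G m
  open Modular m
  open Encoding G
  open import Data.Integer using (_+_)

  level : Vtx → ℤ
  level (inj₁ (_ , i)) = toℤ i
  level (inj₂ _)       = + 0

  Unpinned : Vtx → Set
  Unpinned v = ¬ T (pinned (code (proj v)))

  step-level : ∀ {u v} → Unpinned u → Unpinned v → (st : Step u v) → level v ≡ₘ level u + proj₁ st
  step-level {inj₁ (_ , i)} {inj₁ _} _  _  (a , _ , refl) = shift-≡ₘ i a
  step-level {inj₂ p}                un _  _              = contradiction (pinned-code p) un
  step-level {inj₁ _}       {inj₂ q} _  un _              = contradiction (pinned-code q) un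

  module _ (adj : ℕ → List (ℕ × ℤ)) (M budget : ℕ) (simple : IsSimple B.edges) (covers : TableCovers adj)
           (searched : ClosedWalksAcceptable adj M budget) (M≤m : M ≤ m) where
    open ClosedWalkSearch adj pinned M

    dart∈adj : ∀ {s t a} → Dart G s t a → (code t , a) ∈ adj (code s)
    dart∈adj (forward  ℓ∈ refl refl) = proj₁ (All.lookup covers ℓ∈)
    dart∈adj (backward ℓ∈ refl refl) = proj₂ (All.lookup covers ℓ∈)

    unpinned-steps-injective : ∀ {w u v} → Unpinned w → Step w u → Step w v → proj u ≡ proj v → u ≡ v
    unpinned-steps-injective {inj₁ _} _  = lifted-steps-injective simple
    unpinned-steps-injective {inj₂ p} un = contradiction (pinned-code p) un

    module ShortCycle {n} (2≤n : 2 ≤ n) (n≤budget : n ≤ budget) (f : Fin (suc n) → Vtx) (g : Fin (suc n) → Edge)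
                      (f-inj : Injective _≡_ _≡_ f) (joins : ∀ j → Joins (g j) (f j) (f (next j))) where

      position : ℕ → Fin (suc n)
      position = fold Fin.zero next

      F : ℕ → Vtx
      F = f ∘ position

      step : ∀ j → Step (F j) (F (suc j))
      step j = joins⇒step (joins (position j))

      back-step : ∀ j → Step (F (suc j)) (F j)
      back-step j = joins⇒step (joins-sym (joins (position j)))

      B : ℕ → ℕ
      B = code ∘ proj ∘ F

      a : ℕ → ℤ
      a = proj₁ ∘ step

      F-period : F (suc n) ≡ F 0
      F-period = cong f fold-next-period

      -- Turning back at F (suc j) would make F (suc (suc j)) = F j although j and 2 + j differ mod suc n.
      reduced : ∀ j → ¬ T (backtracks (B j) (B (suc j)) (B (suc (suc j))))
      reduced j backtrack with Equivalence.to Bool.T-∧ backtrack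
      ... | unpinned , same = next²≢id 2≤n (position j) (sym (f-inj Fj≡Fj+2))
        where
        Fj≡Fj+2 : F j ≡ F (suc (suc j))
        Fj≡Fj+2 = unpinned-steps-injective (T-not⇒¬T unpinned) (back-step j) (step (suc j))
                    (sym (code-injective (ℕ.≡ᵇ⇒≡ _ _ same)))

      open Walk B a (dart∈adj ∘ proj₁ ∘ proj₂ ∘ step) reduced

      closing-facts : ¬ T (visitsPinned n) × 0 < ∣ voltage n ∣ × ∣ voltage n ∣ < M
      closing-facts = acceptable-sound {visitsPinned n} {voltage n}
        (closed-walk-acceptable (cong (code ∘ proj) F-period) (cong (code ∘ proj ∘ f ∘ next) fold-next-period)
                                searched (code< (proj (F 0))) (ℕ.≤-trans (s≤s z≤n) 2≤n) n≤budget)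

      unpinned : ∀ i → i ≤ suc n → Unpinned (F i)
      unpinned = unpinned-upto n (proj₁ closing-facts)

      telescope : ∀ j → j ≤ n → level (F (suc j)) ≡ₘ level (F 0) + voltage j
      telescope zero    _     = step-level (unpinned 0 z≤n) (unpinned 1 (s≤s z≤n)) (step 0)
      telescope (suc j) j+1≤n = begin
        level (F (suc (suc j)))
          ≈⟨ step-level (unpinned (suc j) (ℕ.m≤n⇒m≤1+n j+1≤n)) (unpinned (suc (suc j)) (s≤s j+1≤n)) (step (suc j)) ⟩
        level (F (suc j)) + a (suc j)          ≈⟨ +-congʳ-≡ₘ (a (suc j)) (telescope j (ℕ.m+n≤o⇒n≤o 1 j+1≤n)) ⟩
        level (F 0) + voltage j + a (suc j)    ≡⟨ ℤ.+-assoc (level (F 0)) (voltage j) (a (suc j)) ⟩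
        level (F 0) + voltage (suc j)          ∎
        where open SetoidReasoning ≡ₘ-setoid

      impossible : ⊥
      impossible = contradiction (cong ∣_∣ (∣∧small⇒≡0 m∣voltage (ℕ.<-≤-trans (proj₂ (proj₂ closing-facts)) M≤m)))
                                 (ℕ.>⇒≢ (proj₁ (proj₂ closing-facts)))
        where
        m∣voltage : + m ∣ voltage n
        m∣voltage = +-≡ₘ-cancel (level (F 0))
                      (≡ₘ-sym (subst (λ v → level v ≡ₘ level (F 0) + voltage n) F-period (telescope n ℕ.≤-refl)))

    girth-lower-bound : ∀ k → HasCycle k → suc (suc budget) ≤ k
    girth-lower-bound zero    ()
    girth-lower-bound (suc n) cycle@(f , g , f-inj , _ , joins) with suc (suc budget) ℕ.≤? suc n
    ... | yes long  = long
    ... | no  short = ⊥-elim (ShortCycle.impossible (ℕ.≤-pred (simple⇒3≤length (derived-simple simple) cycle))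
                                                    (ℕ.≤-pred (ℕ.≤-pred (ℕ.≰⇒> short))) f g f-inj joins)

-- Row c lists the pairs (code of neighbour, voltage of the dart) at the vertex of code c:
-- x, x0, …, z111 have codes 0, …, 48 in the order of G12-vertices, and x*, y*, z* have 49, 50, 51.
-- The search runs on this literal table, which evaluates far faster than one computed from G12.
G12-adjacency : List (List (ℕ × ℤ))
G12-adjacency =
  ((1 , + 0) ∷ (2 , + 0) ∷ (49 , + 0) ∷ []) ∷
  ((0 , + 0) ∷ (3 , + 0) ∷ (4 , + 0) ∷ []) ∷
  ((0 , + 0) ∷ (5 , + 0) ∷ (6 , + 0) ∷ []) ∷
  ((1 , + 0) ∷ (26 , + 0) ∷ (38 , + 0) ∷ []) ∷
  ((1 , + 0) ∷ (7 , + 0) ∷ (8 , + 0) ∷ []) ∷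
  ((2 , + 0) ∷ (9 , + 0) ∷ (10 , + 0) ∷ []) ∷
  ((2 , + 0) ∷ (11 , + 0) ∷ (12 , + 0) ∷ []) ∷
  ((4 , + 0) ∷ (13 , + 0) ∷ (14 , + 0) ∷ []) ∷
  ((4 , + 0) ∷ (15 , + 0) ∷ (16 , + 0) ∷ []) ∷
  ((5 , + 0) ∷ (17 , + 0) ∷ (18 , + 0) ∷ []) ∷
  ((5 , + 0) ∷ (19 , + 0) ∷ (20 , + 0) ∷ []) ∷
  ((6 , + 0) ∷ (21 , + 0) ∷ (22 , + 0) ∷ []) ∷
  ((6 , + 0) ∷ (23 , + 0) ∷ (24 , + 0) ∷ []) ∷
  ((7 , + 0) ∷ (31 , + 1) ∷ (47 , + 2) ∷ []) ∷
  ((7 , + 0) ∷ (32 , + 2) ∷ (48 , + 1) ∷ []) ∷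
  ((8 , + 0) ∷ (33 , + 1) ∷ (45 , - + 1) ∷ []) ∷
  ((8 , + 0) ∷ (34 , + 2) ∷ (46 , + 3) ∷ []) ∷
  ((9 , + 0) ∷ (31 , + 2) ∷ (43 , - + 1) ∷ []) ∷
  ((9 , + 0) ∷ (32 , + 1) ∷ (44 , + 3) ∷ []) ∷
  ((10 , + 0) ∷ (35 , + 1) ∷ (45 , + 1) ∷ []) ∷
  ((10 , + 0) ∷ (36 , + 2) ∷ (46 , - + 1) ∷ []) ∷
  ((11 , + 0) ∷ (33 , + 2) ∷ (43 , - + 3) ∷ []) ∷
  ((11 , + 0) ∷ (34 , + 1) ∷ (44 , - + 2) ∷ []) ∷
  ((12 , + 0) ∷ (35 , + 3) ∷ (47 , - + 1) ∷ []) ∷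
  ((12 , + 0) ∷ (36 , - + 1) ∷ (48 , + 2) ∷ []) ∷
  ((26 , + 0) ∷ (27 , + 0) ∷ (50 , + 0) ∷ []) ∷
  ((25 , + 0) ∷ (28 , + 0) ∷ (3 , + 0) ∷ []) ∷
  ((25 , + 0) ∷ (29 , + 0) ∷ (30 , + 0) ∷ []) ∷
  ((26 , + 0) ∷ (31 , + 0) ∷ (32 , + 0) ∷ []) ∷
  ((27 , + 0) ∷ (33 , + 0) ∷ (34 , + 0) ∷ []) ∷
  ((27 , + 0) ∷ (35 , + 0) ∷ (36 , + 0) ∷ []) ∷
  ((28 , + 0) ∷ (13 , - + 1) ∷ (17 , - + 2) ∷ []) ∷
  ((28 , + 0) ∷ (14 , - + 2) ∷ (18 , - + 1) ∷ []) ∷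
  ((29 , + 0) ∷ (15 , - + 1) ∷ (21 , - + 2) ∷ []) ∷
  ((29 , + 0) ∷ (16 , - + 2) ∷ (22 , - + 1) ∷ []) ∷
  ((30 , + 0) ∷ (19 , - + 1) ∷ (23 , - + 3) ∷ []) ∷
  ((30 , + 0) ∷ (20 , - + 2) ∷ (24 , + 1) ∷ []) ∷
  ((38 , + 0) ∷ (39 , + 0) ∷ (51 , + 0) ∷ []) ∷
  ((37 , + 0) ∷ (40 , + 0) ∷ (3 , + 0) ∷ []) ∷
  ((37 , + 0) ∷ (41 , + 0) ∷ (42 , + 0) ∷ []) ∷
  ((38 , + 0) ∷ (43 , + 0) ∷ (44 , + 0) ∷ []) ∷
  ((39 , + 0) ∷ (45 , + 0) ∷ (46 , + 0) ∷ []) ∷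
  ((39 , + 0) ∷ (47 , + 0) ∷ (48 , + 0) ∷ []) ∷
  ((40 , + 0) ∷ (17 , + 1) ∷ (21 , + 3) ∷ []) ∷
  ((40 , + 0) ∷ (18 , - + 3) ∷ (22 , + 2) ∷ []) ∷
  ((41 , + 0) ∷ (15 , + 1) ∷ (19 , - + 1) ∷ []) ∷
  ((41 , + 0) ∷ (16 , - + 3) ∷ (20 , + 1) ∷ []) ∷
  ((42 , + 0) ∷ (13 , - + 2) ∷ (23 , + 1) ∷ []) ∷
  ((42 , + 0) ∷ (14 , - + 1) ∷ (24 , - + 2) ∷ []) ∷
  ((0 , + 0) ∷ []) ∷
  ((25 , + 0) ∷ []) ∷
  ((37 , + 0) ∷ []) ∷
  []

adj₁₂ : ℕ → List (ℕ × ℤ)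
adj₁₂ c = fromMaybe [] (head (drop c G12-adjacency))

module B₁₂ = MultiGraph (BaseGraph G12)
open Encoding G12

G12-simple : IsSimple B₁₂.edges
G12-simple = toWitness {a? = isSimple? B₁₂._≟V_ B₁₂.edges} tt

G12-table-covers : TableCovers adj₁₂
G12-table-covers = toWitness {a? = tableCovers? adj₁₂} tt

G12-closed-walks : ClosedWalksAcceptable adj₁₂ 9 10
G12-closed-walks = refl

G12-deg-unpinned : ∀ u → B₁₂.deg (inj₁ u) ≡ 3
G12-deg-unpinned = toWitness {a? = Finₚ.all? (λ u → B₁₂.deg (inj₁ u) ℕ.≟ 3)} tt

G12-deg-pinned : ∀ p → B₁₂.deg (inj₂ p) ≡ 1
G12-deg-pinned = toWitness {a? = Finₚ.all? (λ p → B₁₂.deg (inj₂ p) ℕ.≟ 1)} tt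

G12-twelve-cycle : ∀ m .{{_ : NonZero m}} → 2 ≤ m → MultiGraph.HasCycle (Derived G12 m) 12
G12-twelve-cycle 1 (s≤s ())
G12-twelve-cycle (suc (suc k)) _ = cycle⁺ (s≤s (s≤s z≤n)) f f-injective (zeroLift⇒adjacent ∘ adjacent)
  where
  open MultiGraph (Derived G12 (suc (suc k)))
  open MultiGraphProperties (Derived G12 (suc (suc k)))
  open DerivedGraph G12 (suc (suc k))

  0ₗ 1ₗ : Fin (suc (suc k))
  0ₗ = Fin.zero
  1ₗ = Fin.suc Fin.zero

  f : Fin 12 → Vtx
  f = lookupᵥ (inj₂ x* ∷ inj₁ (x , 0ₗ) ∷ inj₁ (x0 , 0ₗ) ∷ inj₁ (x00 , 0ₗ) ∷ inj₁ (y0 , 0ₗ) ∷ inj₁ (y , 0ₗ) ∷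
               inj₂ y* ∷ inj₁ (y , 1ₗ) ∷ inj₁ (y0 , 1ₗ) ∷ inj₁ (x00 , 1ₗ) ∷ inj₁ (x0 , 1ₗ) ∷ inj₁ (x , 1ₗ) ∷ [])

  f-injective : Injective _≡_ _≡_ f
  f-injective {i} {j} = toWitness {a? = Finₚ.all? (λ i → Finₚ.all? (λ j → (f i ≟V f j) →-dec (i Finₚ.≟ j)))} tt i j

  adjacent : ∀ j → ZeroLift (f j) (f (next j))
  adjacent = toWitness {a? = Finₚ.all? (λ j → zeroLift? (f j) (f (next j)))} tt

theorem6 : (m : ℕ) .{{_ : NonZero m}} → 9 ≤ m →
    let open MultiGraph (Derived G12 m) in
      HasGirth 12
      × (∀ v → deg v ≡ 3 ⊎ deg v ≡ m)
      × deg (inj₂ x*) ≡ m × deg (inj₂ y*) ≡ m × deg (inj₂ z*) ≡ m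
      × #deg m ≡ 3
      × #deg 3 ≡ 49 * m
theorem6 m 9≤m =
  (G12-twelve-cycle m (ℕ.≤-trans (s≤s (s≤s z≤n)) 9≤m) ,
   girth-lower-bound adj₁₂ 9 10 G12-simple G12-table-covers G12-closed-walks 9≤m) ,
  (λ { (inj₁ (u , j)) → inj₁ (deg≡3 u j) ; (inj₂ p) → inj₂ (deg≡m p) }) ,
  deg≡m x* , deg≡m y* , deg≡m z* ,
  proj₂ counts , proj₁ counts
  where
  open MultiGraph (Derived G12 m)
  open DerivedGraph G12 m
  open GirthLowerBound G12 m

  deg≡3 : ∀ u j → deg (inj₁ (u , j)) ≡ 3
  deg≡3 u j = trans (deg-lift u j) (G12-deg-unpinned u)

  deg≡m : ∀ p → deg (inj₂ p) ≡ m
  deg≡m p = trans (deg-pinned p) (trans (cong (m *_) (G12-deg-pinned p)) (ℕ.*-identityʳ m))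

  counts : #deg 3 ≡ 49 * m × #deg m ≡ 3
  counts = count-degrees (ℕ.<⇒≢ (ℕ.<-≤-trans (s≤s (s≤s (s≤s (s≤s z≤n)))) 9≤m)) deg≡3 deg≡m
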